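{- Let $N$ be a set of ground closures with associated rewrite systems $R_s$ (for ground terms $s$) and $R_*$. Let $s$ be a ground term and $(C\cdot\theta)$ a ground closure. If every term that occurs in negative literals of $C\theta$ is $\prec s$, every term that occurs in positive literals of $C\theta$ is $\preceq s$, and $R_s\models(C\cdot\theta)$, then $R_*\models(C\cdot\theta)$.
   Context: $\succ$ is a reduction ordering on terms, total on ground terms. Clauses are finite multisets of literals $s\approx t$, $s\not\approx t$ ($\approx$ symmetric); $\succ_L$ maps $s\approx t$ to $\{s,t\}$ and $s\not\approx t$ to $\{s,s,t,t\}$ compared via the multiset extension of $\succ$; $\succ_C$ is the multiset extension of $\succ_L$. A ground closure $(C\cdot\theta)$: clause $C$ and substitution $\theta$ with $C\theta$ ground (identified up to bijective renaming of $C$ when instances coincide). For a ground rewrite system $R$, $R\models(C\cdot\theta)$ means $C\theta$ is true in the equational interpretation generated by $R$. For a left-reduced ground rewrite system $R$ contained in $\succ$ (i.e. $u\succ v$ for all rules, no left-hand side reducible by the other rules) there is a well-founded ordering $\succ\!\!\succ_R$ on ground closures (the $R$-normalization closure ordering, which first compares multisets of labeled $R$-redexes and $R$-normal forms of the closures, then the ground instances by $\succ_C$, then by a fixed auxiliary closure ordering). Construction from $N$: by induction on ground terms $s$ w.r.t. $\succ$, $R_s=\bigcup_{t\prec s}E_t$, and $E_s=\{s\to s'\}$ if $(C\cdot\theta)$ is the $\succ\!\!\succ_{R_s}$-smallest closure in $N$ such that $C=C'\lor u\approx u'$, $s=u\theta$ is a strictly maximal term in $C\theta$ (all other terms occurring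 in $C\theta$ are $\prec s$), occurs only in positive literals of $C\theta$, and is $R_s$-irreducible, $s'=u'\theta$, $C\theta$ is false in $R_s$, and $s\succ s'$; $E_s=\emptyset$ if no such closure exists. $R_*=\bigcup_tE_t$. -}

module Defs where

open import Data.Nat using (ℕ)
open import Data.Fin using (Fin)
open import Data.Vec using (Vec; []; _∷_; _[_]≔_; lookup)
open import Data.List using (List; []; _∷_)
open import Data.List.Relation.Unary.Any using (Any)
open import Data.List.Relation.Unary.All using (All)
open import Data.List.Membership.Propositional using (_∈_)
open import Data.Product using (Σ; ∃; _×_; _,_; Σ-syntax; ∃-syntax)
open import Data.Sum using (_⊎_)
open import Data.Empty using (⊥)
open import Data.Unit using (⊤)
open import Relation.Nullary using (¬_)
open import Relation.Binary.PropositionalEquality using (_≡_; _≢_)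
open import Induction.WellFounded using (WellFounded)

record Signature : Set₁ where
  field
    Fun   : Set
    arity : Fun → ℕ

open Signature public

data Term (Sig : Signature) (V : Set) : Set where
  var : V → Term Sig V
  fun : (f : Fun Sig) → Vec (Term Sig V) (arity Sig f) → Term Sig V

GTerm : Signature → Set
GTerm Sig = Term Sig ⊥

-- Literals s ≈ t (pos) and s ≉ t (neg); clauses are finite multisets of
-- literals, represented by lists (order is irrelevant everywhere below).
data Lit (Sig : Signature) (V : Set) : Set where
  pos : Term Sig V → Term Sig V → Lit Sig V
  neg : Term Sig V → Term Sig V → Lit Sig V

Clause : Signature → Set → Set
Clause Sig V = List (Lit Sig V)

record Closure (Sig : Signature) : Set where
  constructor _·_
  field
    clause : Clause Sig ℕ
    subst  : ℕ → GTerm Sig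

open Closure public

module _ {Sig : Signature} where

  mutual
    _⟪_⟫ : {V W : Set} → Term Sig V → (V → Term Sig W) → Term Sig W
    var x ⟪ σ ⟫ = σ x
    fun f ts ⟪ σ ⟫ = fun f (ts ⟪ σ ⟫*)

    _⟪_⟫* : {V W : Set} {n : ℕ} → Vec (Term Sig V) n → (V → Term Sig W) → Vec (Term Sig W) n
    [] ⟪ σ ⟫* = []
    (t ∷ ts) ⟪ σ ⟫* = (t ⟪ σ ⟫) ∷ (ts ⟪ σ ⟫*)

  litSubst : {V W : Set} → Lit Sig V → (V → Term Sig W) → Lit Sig W
  litSubst (pos s t) σ = pos (s ⟪ σ ⟫) (t ⟪ σ ⟫)
  litSubst (neg s t) σ = neg (s ⟪ σ ⟫) (t ⟪ σ ⟫)

  clauseSubst : {V W : Set} → Clause Sig V → (V → Term Sig W) → Clause Sig W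
  clauseSubst [] σ = []
  clauseSubst (L ∷ C) σ = litSubst L σ ∷ clauseSubst C σ

  inst : Closure Sig → Clause Sig ⊥
  inst c = clauseSubst (clause c) (subst c)

  Rules : Set₁
  Rules = GTerm Sig → GTerm Sig → Set

  data _⊢_≈_ (R : Rules) : GTerm Sig → GTerm Sig → Set where
    rule  : ∀ {s t} → R s t → R ⊢ s ≈ t
    refl  : ∀ {s} → R ⊢ s ≈ s
    sym   : ∀ {s t} → R ⊢ s ≈ t → R ⊢ t ≈ s
    trans : ∀ {s t u} → R ⊢ s ≈ t → R ⊢ t ≈ u → R ⊢ s ≈ u
    cong  : ∀ f (ts : Vec (GTerm Sig) (arity Sig f)) (i : Fin (arity Sig f)) {u} →
            R ⊢ lookup ts i ≈ u → R ⊢ fun f ts ≈ fun f (ts [ i ]≔ u)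

  LitTrue : Rules → Lit Sig ⊥ → Set
  LitTrue R (pos s t) = R ⊢ s ≈ t
  LitTrue R (neg s t) = ¬ (R ⊢ s ≈ t)

  _⊨_ : Rules → Clause Sig ⊥ → Set
  R ⊨ C = Any (LitTrue R) C

  data Reducible (R : Rules) : GTerm Sig → Set where
    root : ∀ {t t'} → R t t' → Reducible R t
    arg  : ∀ f (ts : Vec (GTerm Sig) (arity Sig f)) (i : Fin (arity Sig f)) →
           Reducible R (lookup ts i) → Reducible R (fun f ts)

  record IsGroundReductionOrdering (_≻_ : GTerm Sig → GTerm Sig → Set) : Set where
    field
      irrefl : ∀ {s} → ¬ (s ≻ s)
      trans≻ : ∀ {s t u} → s ≻ t → t ≻ u → s ≻ u
      wf     : WellFounded (λ s t → t ≻ s)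
      total  : ∀ s t → s ≻ t ⊎ s ≡ t ⊎ t ≻ s
      compat : ∀ {s t} f (ts : Vec (GTerm Sig) (arity Sig f)) (i : Fin (arity Sig f)) →
               s ≻ t → fun f (ts [ i ]≔ s) ≻ fun f (ts [ i ]≔ t)

  module _ (_≻_ : GTerm Sig → GTerm Sig → Set) where

    BothSides : (GTerm Sig → Set) → Lit Sig ⊥ → Set
    BothSides P (pos a b) = P a × P b
    BothSides P (neg a b) = P a × P b

    NegBelow : GTerm Sig → Lit Sig ⊥ → Set
    NegBelow s (pos a b) = ⊤
    NegBelow s (neg a b) = (s ≻ a) × (s ≻ b)

    PosAtMost : GTerm Sig → Lit Sig ⊥ → Set
    PosAtMost s (pos a b) = (s ≻ a ⊎ a ≡ s) × (s ≻ b ⊎ b ≡ s)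
    PosAtMost s (neg a b) = ⊤

    NotInNeg : GTerm Sig → Lit Sig ⊥ → Set
    NotInNeg s (pos a b) = ⊤
    NotInNeg s (neg a b) = (a ≢ s) × (b ≢ s)

    -- R_s for a family of rules E (E s s' means s → s' ∈ E_s):
    -- the union of E_t over t ≺ s.
    Below : Rules → GTerm Sig → Rules
    Below E s l r = (s ≻ l) × E l r

    Productive : Rules → GTerm Sig → GTerm Sig → Closure Sig → Set
    Productive R s s' c =
      Σ[ u ∈ Term Sig ℕ ] Σ[ u' ∈ Term Sig ℕ ]
        ((pos u u' ∈ clause c) ⊎ (pos u' u ∈ clause c)) ×
        (s ≡ u ⟪ subst c ⟫) ×
        (s' ≡ u' ⟪ subst c ⟫) ×
        All (BothSides (λ t → t ≡ s ⊎ s ≻ t)) (inst c) ×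
        All (NotInNeg s) (inst c) ×
        ¬ Reducible R s ×
        ¬ (R ⊨ inst c) ×
        (s ≻ s')

    -- Specification of the construction of E_s (hence R_s, R_*) from N,
    -- given the closure orderings CO R (CO R c d : c ≻≻_R d).
    -- E s s' holds iff E_s = {s → s'}.
    record IsConstruction (CO : Rules → Closure Sig → Closure Sig → Set)
                          (N : Closure Sig → Set) (E : Rules) : Set₁ where
      field
        functional : ∀ {s a b} → E s a → E s b → a ≡ b
        sound      : ∀ {s s'} → E s s' →
                     Σ[ c ∈ Closure Sig ] N c × Productive (Below E s) s s' c ×
                       (∀ d {t'} → N d → Productive (Below E s) s t' d →
                          ¬ CO (Below E s) c d)
        complete   : ∀ s (c : Closure Sig) {t'} → N c →
                     Productive (Below E s) s t' c → ∃[ s' ] E s s'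

{-# OPTIONS --safe #-}
module Submission where

-- R_* is a left-reduced ground rewrite system contained in ≻, hence convergent:
-- R_*-convertible terms have the same R_*-normal form.  Normalising a term t only
-- uses rules whose left-hand sides are ⪯ t, so for a, b ≺ s the joining rewrite
-- sequences are already R_s-sequences.  Hence a negative literal a ≉ b of Cθ,
-- true in R_s, stays true in R_*.

open import Defs
open import Data.List.Relation.Unary.All as All using (All)

open import Data.Nat using (ℕ; suc; _+_; _≤_; _<_; s≤s)
open import Data.Nat.Properties using (m≤m+n; m≤n+m; ≤-trans; <⇒≢)
open import Data.Fin using (zero; suc)
open import Data.Vec using (Vec; []; _∷_; _[_]≔_; lookup)
open import Data.Vec.Properties using ([]≔-lookup; []≔-idempotent; lookup∘update)
open import Data.Vec.Relation.Binary.Pointwise.Inductive using (Pointwise; []; _∷_)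
open import Data.List.Membership.Propositional using (find; lose)
open import Data.Product using (∃; _,_; proj₂)
open import Data.Sum using (inj₁; inj₂)
open import Data.Empty using (⊥-elim)
open import Effect.Monad using (RawMonad)
open import Level using (0ℓ)
open import Function using (_∘_; case_of_)
open import Induction.WellFounded using (Acc; acc)
open import Relation.Binary using (Rel; Reflexive; Transitive; DecidableEquality)
import Relation.Binary.Construct.StrictToNonStrict as StrictToNonStrict
open import Relation.Binary.PropositionalEquality as ≡ using (_≡_; _≢_; refl)
open import Relation.Nullary using (¬_; yes; no)
open import Relation.Nullary.Decidable using (decidable-stable; ¬¬-excluded-middle)
open import Relation.Nullary.Negation using (¬¬-Monad)

open RawMonad (¬¬-Monad {a = 0ℓ}) using (return; _>>=_)

module _ {Sig : Signature} where

  private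
    T : Set
    T = GTerm Sig

  mutual
    size : T → ℕ
    size (fun f ts) = suc (sizes ts)

    sizes : ∀ {k} → Vec T k → ℕ
    sizes [] = 0
    sizes (t ∷ ts) = size t + sizes ts

  size-lookup< : ∀ f (ts : Vec T (arity Sig f)) i → size (lookup ts i) < size (fun f ts)
  size-lookup< f ts i = s≤s (lookup≤sizes ts i)
    where
    lookup≤sizes : ∀ {k} (ts : Vec T k) i → size (lookup ts i) ≤ sizes ts
    lookup≤sizes (t ∷ ts) zero = m≤m+n (size t) (sizes ts)
    lookup≤sizes (t ∷ ts) (suc i) = ≤-trans (lookup≤sizes ts i) (m≤n+m (sizes ts) (size t))

  lookup≢fun : ∀ f (ts : Vec T (arity Sig f)) i → lookup ts i ≢ fun f ts
  lookup≢fun f ts i eq = <⇒≢ (size-lookup< f ts i) (≡.cong size eq)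

  module _ {ℓ} {_∼_ : Rel T ℓ} (∼-refl : Reflexive _∼_) (∼-trans : Transitive _∼_) where

    pointwise-compatible : ∀ {k} (F : Vec T k → T) →
                           (∀ ws i {s t} → s ∼ t → F (ws [ i ]≔ s) ∼ F (ws [ i ]≔ t)) →
                           ∀ {us vs} → Pointwise _∼_ us vs → F us ∼ F vs
    pointwise-compatible F compatible [] = ∼-refl
    pointwise-compatible F compatible {u ∷ us} {v ∷ vs} (u∼v ∷ us∼vs) =
      ∼-trans (compatible (u ∷ us) zero u∼v)
              (pointwise-compatible (F ∘ (v ∷_)) (λ ws i → compatible (v ∷ ws) (suc i)) us∼vs)

  ¬¬-pointwise : {P : T → T → Set} → ∀ {k} (ts : Vec T k) →
                 (∀ i → ¬ ¬ ∃ (P (lookup ts i))) → ¬ ¬ ∃ λ (us : Vec T k) → Pointwise P ts us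
  ¬¬-pointwise [] _ = return ([] , [])
  ¬¬-pointwise (t ∷ ts) exists = do
    n , Ptn ← exists zero
    ns , Ptsns ← ¬¬-pointwise ts (exists ∘ suc)
    return (n ∷ ns , Ptn ∷ Ptsns)

  ⊢-mono : {R R′ : Rules {Sig}} → (∀ {l r} → R l r → R′ l r) → ∀ {s t} → R ⊢ s ≈ t → R′ ⊢ s ≈ t
  ⊢-mono R⊆R′ (rule l→r) = rule (R⊆R′ l→r)
  ⊢-mono R⊆R′ refl = refl
  ⊢-mono R⊆R′ (sym t≈s) = sym (⊢-mono R⊆R′ t≈s)
  ⊢-mono R⊆R′ (trans s≈u u≈t) = trans (⊢-mono R⊆R′ s≈u) (⊢-mono R⊆R′ u≈t)
  ⊢-mono R⊆R′ (cong f ts i ti≈u) = cong f ts i (⊢-mono R⊆R′ ti≈u)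

  ⊢-cong-fun : {R : Rules {Sig}} → ∀ f {us vs} → Pointwise (R ⊢_≈_) us vs → R ⊢ fun f us ≈ fun f vs
  ⊢-cong-fun {R} f = pointwise-compatible refl trans (fun f) cong-update
    where
    cong-update : ∀ ws i {s t} → R ⊢ s ≈ t → R ⊢ fun f (ws [ i ]≔ s) ≈ fun f (ws [ i ]≔ t)
    cong-update ws i {s} {t} s≈t =
      ≡.subst (λ vs → R ⊢ fun f (ws [ i ]≔ s) ≈ fun f vs) ([]≔-idempotent ws i)
        (cong f (ws [ i ]≔ s) i (≡.subst (λ u → R ⊢ u ≈ t) (≡.sym (lookup∘update i ws s)) s≈t))

  module GroundOrder {_≻_ : T → T → Set} (ord : IsGroundReductionOrdering _≻_) where

    open IsGroundReductionOrdering ord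

    _≺_ : T → T → Set
    s ≺ t = t ≻ s

    _≟_ : DecidableEquality T
    s ≟ t with total s t
    ... | inj₁ s≻t = no λ { refl → irrefl s≻t }
    ... | inj₂ (inj₁ s≡t) = yes s≡t
    ... | inj₂ (inj₂ t≻s) = no λ { refl → irrefl t≻s }

    monotone⇒¬x≻gx : (g : T → T) → (∀ {s t} → s ≻ t → g s ≻ g t) → ∀ x → ¬ (x ≻ g x)
    monotone⇒¬x≻gx g mono x = descend x (wf x)
      where
      descend : ∀ x → Acc _≺_ x → ¬ (x ≻ g x)
      descend x (acc rs) x≻gx = descend (g x) (rs x≻gx) (mono x≻gx)

    fun≻lookup : ∀ f (ts : Vec T (arity Sig f)) i → fun f ts ≻ lookup ts i
    fun≻lookup f ts i with total (fun f ts) (lookup ts i)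
    ... | inj₁ fun≻ti = fun≻ti
    ... | inj₂ (inj₁ fun≡ti) = ⊥-elim (lookup≢fun f ts i (≡.sym fun≡ti))
    ... | inj₂ (inj₂ ti≻fun) =
      ⊥-elim (monotone⇒¬x≻gx replace (compat f ts i) (fun f ts)
               (≡.subst (λ us → fun f us ≻ replace (fun f ts)) ([]≔-lookup ts i)
                        (compat f ts i ti≻fun)))
      where
      replace : T → T
      replace u = fun f (ts [ i ]≔ u)

    open StrictToNonStrict _≡_ _≻_ using () renaming (_≤_ to _⪰_)

    ⪰-trans : Transitive _⪰_
    ⪰-trans = StrictToNonStrict.trans _≡_ _≻_ ≡.isEquivalence (≡.resp₂ _≻_) trans≻

    ≻-⪰-trans : ∀ {s t u} → s ≻ t → t ⪰ u → s ≻ u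
    ≻-⪰-trans = StrictToNonStrict.<-≤-trans _≡_ _≻_ trans≻ (≡.respʳ _≻_)

    ⪰-≻-trans : ∀ {s t u} → s ⪰ t → t ≻ u → s ≻ u
    ⪰-≻-trans = StrictToNonStrict.≤-<-trans _≡_ _≻_ ≡.sym trans≻ (≡.respˡ _≻_)

    fun-⪰ : ∀ f {us vs} → Pointwise _⪰_ us vs → fun f us ⪰ fun f vs
    fun-⪰ f = pointwise-compatible (inj₂ refl) ⪰-trans (fun f) compatible
      where
      compatible : ∀ ws i {s t} → s ⪰ t → fun f (ws [ i ]≔ s) ⪰ fun f (ws [ i ]≔ t)
      compatible ws i (inj₁ s≻t) = inj₁ (compat f ws i s≻t)
      compatible ws i (inj₂ refl) = inj₂ refl

    reducible-below : ∀ {R L t} → L ≻ t → Reducible R t → Reducible (Below _≻_ R L) t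
    reducible-below L≻t (root t→t′) = root (L≻t , t→t′)
    reducible-below L≻t (arg f ts i red) =
      arg f ts i (reducible-below (trans≻ L≻t (fun≻lookup f ts i)) red)

    module LeftReducedSystem
      (R : Rules {Sig})
      (functional : ∀ {l r r′} → R l r → R l r′ → r ≡ r′)
      (decreasing : ∀ {l r} → R l r → l ≻ r)
      (lhs-irreducible : ∀ {l r} → R l r → ¬ Reducible (Below _≻_ R l) l)
      where

      -- Innermost normalisation, as a relation: R need not be decidable, so normal
      -- forms exist only under ¬ ¬ (⇓-exists).  _⇓ᵣ_ rewrites at the root only.
      mutual
        data _⇓_ : T → T → Set where
          normalize : ∀ {f ts us n} → Pointwise _⇓_ ts us → fun f us ⇓ᵣ n → fun f ts ⇓ n

        data _⇓ᵣ_ : T → T → Set where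
          step : ∀ {t r n} → R t r → r ⇓ n → t ⇓ᵣ n
          stop : ∀ {t} → (∀ r → ¬ R t r) → t ⇓ᵣ t

      mutual
        ⇓-functional : ∀ {t n m} → t ⇓ n → t ⇓ m → n ≡ m
        ⇓-functional (normalize ts⇓us us⇓ᵣn) (normalize ts⇓vs vs⇓ᵣm)
          with refl ← ⇓*-functional ts⇓us ts⇓vs = ⇓ᵣ-functional us⇓ᵣn vs⇓ᵣm

        ⇓*-functional : ∀ {k} {ts us vs : Vec T k} →
                        Pointwise _⇓_ ts us → Pointwise _⇓_ ts vs → us ≡ vs
        ⇓*-functional [] [] = refl
        ⇓*-functional (t⇓u ∷ ts⇓us) (t⇓v ∷ ts⇓vs) =
          ≡.cong₂ _∷_ (⇓-functional t⇓u t⇓v) (⇓*-functional ts⇓us ts⇓vs)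

        ⇓ᵣ-functional : ∀ {t n m} → t ⇓ᵣ n → t ⇓ᵣ m → n ≡ m
        ⇓ᵣ-functional (step t→r r⇓n) (step t→r′ r′⇓m)
          with refl ← functional t→r t→r′ = ⇓-functional r⇓n r′⇓m
        ⇓ᵣ-functional (step t→r _) (stop irr) = ⊥-elim (irr _ t→r)
        ⇓ᵣ-functional (stop irr) (step t→r _) = ⊥-elim (irr _ t→r)
        ⇓ᵣ-functional (stop _) (stop _) = refl

      mutual
        ⇓-decreasing : ∀ {t n} → t ⇓ n → t ⪰ n
        ⇓-decreasing (normalize {f} ts⇓us us⇓ᵣn) =
          ⪰-trans (fun-⪰ f (⇓*-decreasing ts⇓us)) (⇓ᵣ-decreasing us⇓ᵣn)

        ⇓*-decreasing : ∀ {k} {ts us : Vec T k} → Pointwise _⇓_ ts us → Pointwise _⪰_ ts us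
        ⇓*-decreasing [] = []
        ⇓*-decreasing (t⇓u ∷ ts⇓us) = ⇓-decreasing t⇓u ∷ ⇓*-decreasing ts⇓us

        ⇓ᵣ-decreasing : ∀ {t n} → t ⇓ᵣ n → t ⪰ n
        ⇓ᵣ-decreasing (step t→r r⇓n) = inj₁ (≻-⪰-trans (decreasing t→r) (⇓-decreasing r⇓n))
        ⇓ᵣ-decreasing (stop _) = inj₂ refl

      ⇓-exists : ∀ t → Acc _≺_ t → ¬ ¬ ∃ (t ⇓_)
      ⇓-exists (fun f ts) (acc rs) = do
        us , ts⇓us ← ¬¬-pointwise ts λ i → ⇓-exists (lookup ts i) (rs (fun≻lookup f ts i))
        reducible? ← ¬¬-excluded-middle
        case reducible? of λ where
          (no irreducible) → return (fun f us , normalize ts⇓us (stop λ r us→r → irreducible (r , us→r)))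
          (yes (r , us→r)) → do
            n , r⇓n ← ⇓-exists r (rs (⪰-≻-trans (fun-⪰ f (⇓*-decreasing ts⇓us)) (decreasing us→r)))
            return (n , normalize ts⇓us (step us→r r⇓n))

      mutual
        irreducible⇒⇓-self : ∀ t → ¬ Reducible R t → t ⇓ t
        irreducible⇒⇓-self (fun f ts) irr =
          normalize (irreducible*⇒⇓-self ts (λ i → irr ∘ arg f ts i)) (stop λ r ts→r → irr (root ts→r))

        irreducible*⇒⇓-self : ∀ {k} (ts : Vec T k) → (∀ i → ¬ Reducible R (lookup ts i)) →
                              Pointwise _⇓_ ts ts
        irreducible*⇒⇓-self [] _ = []
        irreducible*⇒⇓-self (t ∷ ts) irr =
          irreducible⇒⇓-self t (irr zero) ∷ irreducible*⇒⇓-self ts (irr ∘ suc)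

      lhs-args-irreducible : ∀ {f ts r} → R (fun f ts) r → ∀ i → ¬ Reducible R (lookup ts i)
      lhs-args-irreducible {f} {ts} ts→r i red =
        lhs-irreducible ts→r (arg f ts i (reducible-below (fun≻lookup f ts i) red))

      rule-preserves-⇓ : ∀ {l r n} → R l r → l ⇓ n → r ⇓ n
      rule-preserves-⇓ {fun f ts} {r} ts→r (normalize ts⇓us us⇓ᵣn)
        with refl ← ⇓*-functional (irreducible*⇒⇓-self ts (lhs-args-irreducible ts→r)) ts⇓us =
        rewrite-at-root us⇓ᵣn
        where
        rewrite-at-root : ∀ {n} → fun f ts ⇓ᵣ n → r ⇓ n
        rewrite-at-root (step ts→r′ r⇓n) with refl ← functional ts→r ts→r′ = r⇓n
        rewrite-at-root (stop irr) = ⊥-elim (irr _ ts→r)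

      ⇓*-update : ∀ {k} i {ts us vs : Vec T k} {u} →
                  (∀ {n m} → lookup ts i ⇓ n → u ⇓ m → n ≡ m) →
                  Pointwise _⇓_ ts us → Pointwise _⇓_ (ts [ i ]≔ u) vs → us ≡ vs
      ⇓*-update zero same (t⇓n ∷ ts⇓us) (u⇓m ∷ ts⇓vs) =
        ≡.cong₂ _∷_ (same t⇓n u⇓m) (⇓*-functional ts⇓us ts⇓vs)
      ⇓*-update (suc i) same (t⇓n ∷ ts⇓us) (t⇓m ∷ ts⇓vs) =
        ≡.cong₂ _∷_ (⇓-functional t⇓n t⇓m) (⇓*-update i same ts⇓us ts⇓vs)

      ⇓-respects-≈ : ∀ {s t n m} → R ⊢ s ≈ t → s ⇓ n → t ⇓ m → n ≡ m
      ⇓-respects-≈ (rule s→t) s⇓n t⇓m = ⇓-functional (rule-preserves-⇓ s→t s⇓n) t⇓m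
      ⇓-respects-≈ refl s⇓n s⇓m = ⇓-functional s⇓n s⇓m
      ⇓-respects-≈ (sym t≈s) s⇓n t⇓m = ≡.sym (⇓-respects-≈ t≈s t⇓m s⇓n)
      ⇓-respects-≈ {n = n} {m} (trans {t = u} s≈u u≈t) s⇓n t⇓m = decidable-stable (n ≟ m) do
        k , u⇓k ← ⇓-exists u (wf u)
        return (≡.trans (⇓-respects-≈ s≈u s⇓n u⇓k) (⇓-respects-≈ u≈t u⇓k t⇓m))
      ⇓-respects-≈ {m = m} (cong f ts i ti≈u) (normalize ts⇓us us⇓ᵣn) (normalize ts′⇓vs vs⇓ᵣm) =
        ⇓ᵣ-functional us⇓ᵣn
          (≡.subst (λ ws → fun f ws ⇓ᵣ m) (≡.sym (⇓*-update i (⇓-respects-≈ ti≈u) ts⇓us ts′⇓vs)) vs⇓ᵣm)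

      mutual
        ⇓-sound-below : ∀ {L t n} → L ≻ t → t ⇓ n → Below _≻_ R L ⊢ t ≈ n
        ⇓-sound-below L≻t (normalize {f} {ts} ts⇓us us⇓ᵣn) =
          trans (⊢-cong-fun f (⇓*-sound-below (trans≻ L≻t ∘ fun≻lookup f ts) ts⇓us))
                (⇓ᵣ-sound-below (≻-⪰-trans L≻t (fun-⪰ f (⇓*-decreasing ts⇓us))) us⇓ᵣn)

        ⇓*-sound-below : ∀ {L k} {ts us : Vec T k} → (∀ i → L ≻ lookup ts i) →
                         Pointwise _⇓_ ts us → Pointwise (Below _≻_ R L ⊢_≈_) ts us
        ⇓*-sound-below _ [] = []
        ⇓*-sound-below L≻ts (t⇓u ∷ ts⇓us) =
          ⇓-sound-below (L≻ts zero) t⇓u ∷ ⇓*-sound-below (L≻ts ∘ suc) ts⇓us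

        ⇓ᵣ-sound-below : ∀ {L t n} → L ≻ t → t ⇓ᵣ n → Below _≻_ R L ⊢ t ≈ n
        ⇓ᵣ-sound-below L≻t (step t→r r⇓n) =
          trans (rule (L≻t , t→r)) (⇓-sound-below (trans≻ L≻t (decreasing t→r)) r⇓n)
        ⇓ᵣ-sound-below L≻t (stop _) = refl

      convertible-below : ∀ {L s t} → L ≻ s → L ≻ t → R ⊢ s ≈ t → ¬ ¬ (Below _≻_ R L ⊢ s ≈ t)
      convertible-below {s = s} {t} L≻s L≻t s≈t = do
        n , s⇓n ← ⇓-exists s (wf s)
        m , t⇓m ← ⇓-exists t (wf t)
        return (trans (⇓-sound-below L≻s s⇓n)
                      (sym (⇓-sound-below L≻t (≡.subst (t ⇓_) (≡.sym (⇓-respects-≈ s≈t s⇓n t⇓m)) t⇓m))))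

      literal-persists : ∀ {L lit} → NegBelow _≻_ L lit → LitTrue (Below _≻_ R L) lit → LitTrue R lit
      literal-persists {lit = pos a b} _ a≈b = ⊢-mono proj₂ a≈b
      literal-persists {lit = neg a b} (L≻a , L≻b) a≉b a≈b = convertible-below L≻a L≻b a≈b a≉b

  module _ {_≻_ : T → T → Set} {CO N E} (con : IsConstruction _≻_ CO N E) where

    open IsConstruction con

    production-decreasing : ∀ {s s′} → E s s′ → s ≻ s′
    production-decreasing s→s′ with sound s→s′
    ... | _ , _ , (_ , _ , _ , _ , _ , _ , _ , _ , _ , s≻s′) , _ = s≻s′

    production-irreducible : ∀ {s s′} → E s s′ → ¬ Reducible (Below _≻_ E s) s
    production-irreducible s→s′ with sound s→s′
    ... | _ , _ , (_ , _ , _ , _ , _ , _ , _ , irreducible , _ , _) , _ = irreducible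

lemma6 : (Sig : Signature) (_≻_ : GTerm Sig → GTerm Sig → Set) →
         IsGroundReductionOrdering _≻_ →
         (CO : Rules → Closure Sig → Closure Sig → Set) →
         (N : Closure Sig → Set) (E : Rules) →
         IsConstruction _≻_ CO N E →
         (s : GTerm Sig) (c : Closure Sig) →
         All (NegBelow _≻_ s) (inst c) →
         All (PosAtMost _≻_ s) (inst c) →
         Below _≻_ E s ⊨ inst c →
         E ⊨ inst c
lemma6 Sig _≻_ ord CO N E con s c negatives-below _ true-below =
  let lit , lit∈Cθ , lit-true = find true-below
  in lose lit∈Cθ (literal-persists (All.lookup negatives-below lit∈Cθ) lit-true)
  where
  open GroundOrder ord
  open LeftReducedSystem E (IsConstruction.functional con)
                           (production-decreasing con) (production-irreducible con)
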